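{- Let $k\geq 2$ be an integer. For any graph $G$ with $\delta(G)\geq k-1$, $$\gamma_{\times k}(G)\leq k\gamma_{k}(G)-(k-1)^2.$$
   Context: All graphs are simple (finite). For $v\in V(G)$, $N(v)$ is the open neighbourhood of $v$, and for $D\subseteq V(G)$, $\deg_D(v)=|N(v)\cap D|$. $\delta(G)$ is the minimum degree of $G$. A set $D\subseteq V(G)$ is a $k$-dominating set of $G$ if $\deg_D(v)\geq k$ for every $v\in V(G)\setminus D$; $\gamma_k(G)$ is the minimum cardinality of a $k$-dominating set. For a positive integer $k\leq \delta(G)+1$, a $k$-dominating set $D$ is a $k$-tuple dominating set if additionally $\deg_D(v)\geq k-1$ for every $v\in D$ (equivalently, every vertex of $G$ is dominated at least $k$ times by $D$, where a vertex dominates itself and its neighbours); $\gamma_{\times k}(G)$ is the minimum cardinality of a $k$-tuple dominating set. -}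

module Defs where

open import Data.Bool using (Bool; true; false)
open import Data.Nat using (ℕ; _≤_; _∸_)
open import Data.Fin using (Fin)
open import Data.Fin.Subset using (Subset; _∈_; _∉_; _∩_; ∣_∣)
open import Data.Vec using (tabulate)
open import Data.Product using (_×_)
open import Relation.Binary.PropositionalEquality using (_≡_)

record Graph (n : ℕ) : Set where
  field
    adj    : Fin n → Fin n → Bool
    sym    : ∀ u v → adj u v ≡ adj v u
    irrefl : ∀ v → adj v v ≡ false
open Graph public

module _ {n : ℕ} (G : Graph n) where

  N : Fin n → Subset n
  N v = tabulate (adj G v)

  degIn : Subset n → Fin n → ℕ
  degIn D v = ∣ N v ∩ D ∣

  deg : Fin n → ℕ
  deg v = ∣ N v ∣

  -- δ(G) ≥ m  (for a graph with at least one vertex)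
  MinDegAtLeast : ℕ → Set
  MinDegAtLeast m = ∀ v → m ≤ deg v

  IsKDom : ℕ → Subset n → Set
  IsKDom k D = ∀ v → v ∉ D → k ≤ degIn D v

  IsKTupleDom : ℕ → Subset n → Set
  IsKTupleDom k D = IsKDom k D × (∀ v → v ∈ D → k ∸ 1 ≤ degIn D v)

  IsMinKDom : ℕ → Subset n → Set
  IsMinKDom k D = IsKDom k D × (∀ D' → IsKDom k D' → ∣ D ∣ ≤ ∣ D' ∣)

  IsMinKTupleDom : ℕ → Subset n → Set
  IsMinKTupleDom k T = IsKTupleDom k T × (∀ T' → IsKTupleDom k T' → ∣ T ∣ ≤ ∣ T' ∣)

{-# OPTIONS --safe #-}
-- Let D be a minimum k-dominating set and c = k − 1. If at least c vertices lie
-- outside D, choose c of them, W. Each has k neighbours in D, so counting the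
-- D–W edges from both sides gives Σ_{v∈D} deg_W(v) ≥ kc. Starting from D ∪ W,
-- repeatedly add a missing neighbour of a vertex of D with fewer than c
-- neighbours in the current set (one exists as δ ≥ c). This adds at most
-- Σ_{v∈D} (c − deg_W(v)) ≤ c|D| − kc vertices and ends in a k-tuple dominating
-- set of size at most |D| + c + c|D| − kc = k|D| − c². If fewer than c vertices
-- lie outside D, the whole vertex set is k-tuple dominating, and |D| ≥ k as soon
-- as some vertex lies outside D, which again gives the bound.
module Submission where

open import Data.Bool using (Bool; true; false; _∧_)
open import Data.Fin using (Fin; zero; suc)
open import Data.Fin.Properties using (any?)
open import Data.Fin.Subset
open import Data.Fin.Subset.Properties
open import Data.Nat using (ℕ; zero; suc; _≤_; _<_; _+_; _*_; _∸_; z≤n; s≤s; z<s; _≤?_; _<?_)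
open import Data.Nat.Induction using (<-wellFounded)
open import Data.Nat.Properties
open import Data.Nat.Tactic.RingSolver using (solve-∀)
open import Algebra.Properties.CommutativeSemigroup *-commutativeSemigroup using (x∙yz≈y∙xz)
open import Algebra.Properties.Semiring.Sum +-*-semiring
  using (sum; sum-syntax; sum-cong-≗; ∑-comm; ∑-distrib-+; *-distribˡ-sum)
open import Data.Product using (∃; _×_; _,_; proj₂)
open import Data.Sum using (inj₂)
open import Data.Vec using ([]; _∷_; lookup)
open import Data.Vec.Properties using (lookup-zipWith; lookup∘tabulate; lookup⇒[]=; []=⇒lookup)
open import Function using (id; _∘_)
open import Induction.WellFounded using (Acc; acc)
open import Relation.Binary.PropositionalEquality using (_≡_; refl; sym; trans; cong; cong₂; module ≡-Reasoning)
open import Relation.Nullary using (yes; no; ¬?; contradiction)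
open import Relation.Nullary.Decidable using (_×-dec_)

open import Defs renaming (sym to adj-sym)

private
  variable
    n : ℕ

𝟙 : Bool → ℕ
𝟙 true  = 1
𝟙 false = 0

𝟙-∧ : ∀ a b → 𝟙 (a ∧ b) ≡ 𝟙 a * 𝟙 b
𝟙-∧ true  true  = refl
𝟙-∧ true  false = refl
𝟙-∧ false _     = refl

𝟙*-mono : ∀ b {x y} → (b ≡ true → x ≤ y) → 𝟙 b * x ≤ 𝟙 b * y
𝟙*-mono true  x≤y = *-monoʳ-≤ 1 (x≤y refl)
𝟙*-mono false _   = z≤n

∑-mono-≤ : {f g : Fin n → ℕ} → (∀ i → f i ≤ g i) → sum f ≤ sum g
∑-mono-≤ {zero}  f≤g = z≤n
∑-mono-≤ {suc n} f≤g = +-mono-≤ (f≤g zero) (∑-mono-≤ (f≤g ∘ suc))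

∑-mono-< : {f g : Fin n → ℕ} → (∀ i → f i ≤ g i) → ∀ i → f i < g i → sum f < sum g
∑-mono-< f≤g zero    fi<gi = +-mono-<-≤ fi<gi (∑-mono-≤ (f≤g ∘ suc))
∑-mono-< f≤g (suc i) fi<gi = +-mono-≤-< (f≤g zero) (∑-mono-< (f≤g ∘ suc) i fi<gi)

∣p∣≡∑𝟙 : (p : Subset n) → ∣ p ∣ ≡ ∑[ i < n ] 𝟙 (lookup p i)
∣p∣≡∑𝟙 []            = refl
∣p∣≡∑𝟙 (inside ∷ p)  = cong suc (∣p∣≡∑𝟙 p)
∣p∣≡∑𝟙 (outside ∷ p) = ∣p∣≡∑𝟙 p

∑∈ : Subset n → (Fin n → ℕ) → ℕ
∑∈ {n} p f = ∑[ i < n ] (𝟙 (lookup p i) * f i)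

syntax ∑∈ p (λ i → x) = ∑[ i ∈ p ] x

∑∈-const : ∀ (p : Subset n) c → ∑[ i ∈ p ] c ≡ c * ∣ p ∣
∑∈-const []            c = sym (*-zeroʳ c)
∑∈-const (inside ∷ p)  c = trans (cong₂ _+_ (+-identityʳ c) (∑∈-const p c)) (sym (*-suc c ∣ p ∣))
∑∈-const (outside ∷ p) c = ∑∈-const p c

∑∈-distrib-+ : ∀ (p : Subset n) (f g : Fin n → ℕ) →
               ∑[ i ∈ p ] (f i + g i) ≡ ∑[ i ∈ p ] f i + ∑[ i ∈ p ] g i
∑∈-distrib-+ p f g = trans
  (sum-cong-≗ λ i → *-distribˡ-+ (𝟙 (lookup p i)) (f i) (g i))
  (∑-distrib-+ (λ i → 𝟙 (lookup p i) * f i) (λ i → 𝟙 (lookup p i) * g i))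

∑∈-mono : ∀ (p : Subset n) {f g : Fin n → ℕ} →
          (∀ {i} → i ∈ p → f i ≤ g i) → ∑[ i ∈ p ] f i ≤ ∑[ i ∈ p ] g i
∑∈-mono p f≤g = ∑-mono-≤ λ i → 𝟙*-mono (lookup p i) (f≤g ∘ lookup⇒[]= i p)

∑∈-mono-< : ∀ (p : Subset n) {f g : Fin n → ℕ} → (∀ {i} → i ∈ p → f i ≤ g i) →
            ∀ {i} → i ∈ p → f i < g i → ∑[ i ∈ p ] f i < ∑[ i ∈ p ] g i
∑∈-mono-< p {f} {g} f≤g {i} i∈p fi<gi =
  ∑-mono-< (λ j → 𝟙*-mono (lookup p j) (f≤g ∘ lookup⇒[]= j p)) i (at-i ([]=⇒lookup i∈p))
  where
  at-i : ∀ {b} → b ≡ true → 𝟙 b * f i < 𝟙 b * g i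
  at-i refl = *-monoʳ-< 1 fi<gi

∣p∪q∣≤∣p∣+∣q∣ : ∀ (p q : Subset n) → ∣ p ∪ q ∣ ≤ ∣ p ∣ + ∣ q ∣
∣p∪q∣≤∣p∣+∣q∣ []            []            = z≤n
∣p∪q∣≤∣p∣+∣q∣ (inside ∷ p)  (y ∷ q)       =
  s≤s (≤-trans (∣p∪q∣≤∣p∣+∣q∣ p q) (+-monoʳ-≤ ∣ p ∣ (∣p∣≤∣x∷p∣ y q)))
∣p∪q∣≤∣p∣+∣q∣ (outside ∷ p) (inside ∷ q)  =
  ≤-trans (s≤s (∣p∪q∣≤∣p∣+∣q∣ p q)) (≤-reflexive (sym (+-suc ∣ p ∣ ∣ q ∣)))
∣p∪q∣≤∣p∣+∣q∣ (outside ∷ p) (outside ∷ q) = ∣p∪q∣≤∣p∣+∣q∣ p q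

∣p∣+∣∁p∣≡n : ∀ (p : Subset n) → ∣ p ∣ + ∣ ∁ p ∣ ≡ n
∣p∣+∣∁p∣≡n p = trans (cong (∣ p ∣ +_) (∣∁p∣≡n∸∣p∣ p)) (m+[n∸m]≡n (∣p∣≤n p))

∩-monoʳ-⊆ : ∀ (p : Subset n) {q r} → q ⊆ r → p ∩ q ⊆ p ∩ r
∩-monoʳ-⊆ p {q} q⊆r x∈p∩q with x∈p∩q⁻ p q x∈p∩q
... | x∈p , x∈q = x∈p∩q⁺ (x∈p , q⊆r x∈q)

∣p∩q∣<∣p∣⇒∃∈p∉q : ∀ (p q : Subset n) → ∣ p ∩ q ∣ < ∣ p ∣ → ∃ λ x → x ∈ p × x ∉ q
∣p∩q∣<∣p∣⇒∃∈p∉q p q ∣p∩q∣<∣p∣ with any? (λ x → x ∈? p ×-dec ¬? (x ∈? q))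
... | yes witness = witness
... | no  none    = contradiction (p⊆q⇒∣p∣≤∣q∣ p⊆p∩q) (<⇒≱ ∣p∩q∣<∣p∣)
  where
  p⊆p∩q : p ⊆ p ∩ q
  p⊆p∩q {x} x∈p with x ∈? q
  ... | yes x∈q = x∈p∩q⁺ (x∈p , x∈q)
  ... | no  x∉q = contradiction (x , x∈p , x∉q) none

subset-of-size : ∀ (p : Subset n) {j} → j ≤ ∣ p ∣ → ∃ λ q → q ⊆ p × ∣ q ∣ ≡ j
subset-of-size []            z≤n = [] , id , refl
subset-of-size (outside ∷ p) j≤∣p∣ with subset-of-size p j≤∣p∣
... | q , q⊆p , ∣q∣≡j = outside ∷ q , s⊆s q⊆p , ∣q∣≡j
subset-of-size {suc n} (inside ∷ p) {zero} _ = ⊥ , ⊥⊆ , ∣⊥∣≡0 (suc n)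
subset-of-size (inside ∷ p) {suc j} (s≤s j≤∣p∣) with subset-of-size p j≤∣p∣
... | q , q⊆p , ∣q∣≡j = inside ∷ q , s⊆s q⊆p , cong suc ∣q∣≡j

o<m⇒o<n⇒m∸n<m∸o : ∀ {m n o} → o < m → o < n → m ∸ n < m ∸ o
o<m⇒o<n⇒m∸n<m∸o {m} {n} {o} o<m o<n = ≤-<-trans (∸-monoʳ-≤ m o<n) (∸-monoʳ-< (n<1+n o) o<m)

large-case-arithmetic : ∀ {t s f e c d} → t ≤ s + f → s ≤ d + c → f + e ≤ c * d → suc c * c ≤ e →
                        t + c * c ≤ suc c * d
large-case-arithmetic {t} {s} {f} {e} {c} {d} t≤s+f s≤d+c f+e≤cd kc≤e = +-cancelʳ-≤ c _ _ (begin
  t + c * c + c      ≡⟨ lhs t c ⟩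
  t + suc c * c      ≤⟨ +-mono-≤ t≤s+f kc≤e ⟩
  s + f + e          ≡⟨ +-assoc s f e ⟩
  s + (f + e)        ≤⟨ +-mono-≤ s≤d+c f+e≤cd ⟩
  d + c + c * d      ≡⟨ rhs d c ⟩
  suc c * d + c      ∎)
  where
  open ≤-Reasoning
  lhs : ∀ t c → t + c * c + c ≡ t + suc c * c
  lhs = solve-∀
  rhs : ∀ d c → d + c + c * d ≡ suc c * d + c
  rhs = solve-∀

small-case-arithmetic : ∀ {m c d} → m < c → (m ≡ 0 → c ≤ d) → (0 < m → suc c ≤ d) → m + c * c ≤ c * d
small-case-arithmetic {zero}  {c} _   c≤d _   = *-monoʳ-≤ c (c≤d refl)
small-case-arithmetic {suc m} {c} m<c _   c<d = begin
  suc m + c * c  ≤⟨ +-monoˡ-≤ (c * c) (<⇒≤ m<c) ⟩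
  c + c * c      ≡⟨ *-suc c c ⟨
  c * suc c      ≤⟨ *-monoʳ-≤ c (c<d z<s) ⟩
  c * _          ∎
  where open ≤-Reasoning

module _ (G : Graph n) where

  degIn-mono : ∀ {S T} → S ⊆ T → ∀ v → degIn G S v ≤ degIn G T v
  degIn-mono S⊆T v = p⊆q⇒∣p∣≤∣q∣ (∩-monoʳ-⊆ (N G v) S⊆T)

  degIn-∪⁅⁆ : ∀ {S v w} → w ∈ N G v → w ∉ S → degIn G S v < degIn G (S ∪ ⁅ w ⁆) v
  degIn-∪⁅⁆ {S} {v} {w} w∈Nv w∉S = p⊂q⇒∣p∣<∣q∣
    ( ∩-monoʳ-⊆ (N G v) (p⊆p∪q ⁅ w ⁆)
    , w , x∈p∩q⁺ (w∈Nv , x∈p∪q⁺ (inj₂ (x∈⁅x⁆ w))) , w∉S ∘ proj₂ ∘ x∈p∩q⁻ (N G v) S )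

  degIn-as-∑ : ∀ S v → degIn G S v ≡ ∑[ u ∈ S ] 𝟙 (adj G v u)
  degIn-as-∑ S v = trans (∣p∣≡∑𝟙 (N G v ∩ S)) (sum-cong-≗ λ u → begin
    𝟙 (lookup (N G v ∩ S) u)           ≡⟨ cong 𝟙 (lookup-zipWith _∧_ u (N G v) S) ⟩
    𝟙 (lookup (N G v) u ∧ lookup S u)  ≡⟨ cong (λ b → 𝟙 (b ∧ lookup S u)) (lookup∘tabulate (adj G v) u) ⟩
    𝟙 (adj G v u ∧ lookup S u)         ≡⟨ 𝟙-∧ (adj G v u) (lookup S u) ⟩
    𝟙 (adj G v u) * 𝟙 (lookup S u)     ≡⟨ *-comm (𝟙 (adj G v u)) (𝟙 (lookup S u)) ⟩
    𝟙 (lookup S u) * 𝟙 (adj G v u)     ∎)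
    where open ≡-Reasoning

  ∑∈-degIn-swap : ∀ A B → ∑[ v ∈ A ] degIn G B v ≡ ∑[ u ∈ B ] degIn G A u
  ∑∈-degIn-swap A B = begin
    ∑[ v ∈ A ] degIn G B v              ≡⟨ as-double-sum A B ⟩
    ∑[ v < n ] ∑[ u < n ] edge A B v u  ≡⟨ ∑-comm (edge A B) ⟩
    ∑[ u < n ] ∑[ v < n ] edge A B v u  ≡⟨ sum-cong-≗ (λ u → sum-cong-≗ (edge-sym u)) ⟩
    ∑[ u < n ] ∑[ v < n ] edge B A u v  ≡⟨ as-double-sum B A ⟨
    ∑[ u ∈ B ] degIn G A u              ∎
    where
    open ≡-Reasoning
    edge : Subset n → Subset n → Fin n → Fin n → ℕ
    edge X Y x y = 𝟙 (lookup X x) * (𝟙 (lookup Y y) * 𝟙 (adj G x y))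
    as-double-sum : ∀ X Y → ∑[ x ∈ X ] degIn G Y x ≡ ∑[ x < n ] ∑[ y < n ] edge X Y x y
    as-double-sum X Y = sum-cong-≗ λ x → trans
      (cong (𝟙 (lookup X x) *_) (degIn-as-∑ Y x))
      (*-distribˡ-sum (𝟙 (lookup X x)) (λ y → 𝟙 (lookup Y y) * 𝟙 (adj G x y)))
    edge-sym : ∀ u v → edge A B v u ≡ edge B A u v
    edge-sym u v = trans
      (x∙yz≈y∙xz (𝟙 (lookup A v)) (𝟙 (lookup B u)) (𝟙 (adj G v u)))
      (cong (λ b → 𝟙 (lookup B u) * (𝟙 (lookup A v) * 𝟙 b)) (adj-sym G v u))

  kDom-edges : ∀ {k D W} → IsKDom G k D → W ⊆ ∁ D → k * ∣ W ∣ ≤ ∑[ v ∈ D ] degIn G W v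
  kDom-edges {k} {D} {W} kDom W⊆∁D = begin
    k * ∣ W ∣               ≡⟨ ∑∈-const W k ⟨
    ∑[ u ∈ W ] k            ≤⟨ ∑∈-mono W (λ {u} u∈W → kDom u (x∈∁p⇒x∉p (W⊆∁D u∈W))) ⟩
    ∑[ u ∈ W ] degIn G D u  ≡⟨ ∑∈-degIn-swap W D ⟩
    ∑[ v ∈ D ] degIn G W v  ∎
    where open ≤-Reasoning

  deficiency : ℕ → Subset n → Subset n → ℕ
  deficiency c A S = ∑[ v ∈ A ] (c ∸ degIn G S v)

  deficiency+edges≤ : ∀ {c A S W} → W ⊆ S → ∣ W ∣ ≤ c →
                      deficiency c A S + ∑[ v ∈ A ] degIn G W v ≤ c * ∣ A ∣
  deficiency+edges≤ {c} {A} {S} {W} W⊆S ∣W∣≤c = begin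
    deficiency c A S + ∑[ v ∈ A ] degIn G W v     ≡⟨ ∑∈-distrib-+ A (λ v → c ∸ degIn G S v) (degIn G W) ⟨
    ∑[ v ∈ A ] ((c ∸ degIn G S v) + degIn G W v)  ≤⟨ ∑∈-mono A (λ {v} _ → at v) ⟩
    ∑[ v ∈ A ] c                                  ≡⟨ ∑∈-const A c ⟩
    c * ∣ A ∣                                     ∎
    where
    open ≤-Reasoning
    at : ∀ v → (c ∸ degIn G S v) + degIn G W v ≤ c
    at v = ≤-trans (+-monoˡ-≤ (degIn G W v) (∸-monoʳ-≤ c (degIn-mono W⊆S v)))
                   (≤-reflexive (m∸n+n≡m (≤-trans (∣p∩q∣≤∣q∣ (N G v) W) ∣W∣≤c)))

  deficiency-step : ∀ {c A S v} → MinDegAtLeast G c → v ∈ A → degIn G S v < c →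
                    ∃ λ w → deficiency c A (S ∪ ⁅ w ⁆) < deficiency c A S
  deficiency-step {c} {A} {S} {v} δ v∈A short
    with ∣p∩q∣<∣p∣⇒∃∈p∉q (N G v) S (<-≤-trans short (δ v))
  ... | w , w∈Nv , w∉S =
    w , ∑∈-mono-< A (λ {u} _ → ∸-monoʳ-≤ c (degIn-mono (p⊆p∪q ⁅ w ⁆) u)) v∈A
                    (o<m⇒o<n⇒m∸n<m∸o short (degIn-∪⁅⁆ w∈Nv w∉S))

  extend-to-cover : ∀ {c} → MinDegAtLeast G c → ∀ A S → Acc _<_ (deficiency c A S) →
                    ∃ λ T → S ⊆ T × (∀ {v} → v ∈ A → c ≤ degIn G T v) × ∣ T ∣ ≤ ∣ S ∣ + deficiency c A S
  extend-to-cover {c} δ A S (acc smaller) with any? (λ v → v ∈? A ×-dec degIn G S v <? c)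
  ... | no none = S , id , (λ {v} v∈A → ≮⇒≥ (λ short → none (v , v∈A , short))) , m≤m+n ∣ S ∣ _
  ... | yes (v , v∈A , short) with deficiency-step δ v∈A short
  ...   | w , fewer with extend-to-cover δ A (S ∪ ⁅ w ⁆) (smaller fewer)
  ...     | T , S∪w⊆T , covered , ∣T∣≤ = T , S∪w⊆T ∘ p⊆p∪q ⁅ w ⁆ , covered , (begin
    ∣ T ∣                                           ≤⟨ ∣T∣≤ ⟩
    ∣ S ∪ ⁅ w ⁆ ∣ + deficiency c A (S ∪ ⁅ w ⁆)      ≤⟨ +-monoˡ-≤ _ (∣p∪q∣≤∣p∣+∣q∣ S ⁅ w ⁆) ⟩
    ∣ S ∣ + ∣ ⁅ w ⁆ ∣ + deficiency c A (S ∪ ⁅ w ⁆)  ≡⟨ cong (λ x → ∣ S ∣ + x + deficiency c A (S ∪ ⁅ w ⁆)) (∣⁅x⁆∣≡1 w) ⟩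
    ∣ S ∣ + 1 + deficiency c A (S ∪ ⁅ w ⁆)          ≡⟨ +-assoc ∣ S ∣ 1 _ ⟩
    ∣ S ∣ + suc (deficiency c A (S ∪ ⁅ w ⁆))        ≤⟨ +-monoʳ-≤ ∣ S ∣ fewer ⟩
    ∣ S ∣ + deficiency c A S                        ∎)
    where open ≤-Reasoning

  kTupleDom-extension : ∀ {c D T} → IsKDom G (suc c) D → D ⊆ T → (∀ {v} → v ∈ D → c ≤ degIn G T v) →
                        IsKTupleDom G (suc c) T
  kTupleDom-extension {c} {D} {T} kDom D⊆T covered =
    (λ v v∉T → outside-D v (v∉T ∘ D⊆T)) , inside-T
    where
    outside-D : ∀ v → v ∉ D → suc c ≤ degIn G T v
    outside-D v v∉D = ≤-trans (kDom v v∉D) (degIn-mono D⊆T v)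
    inside-T : ∀ v → v ∈ T → c ≤ degIn G T v
    inside-T v _ with v ∈? D
    ... | yes v∈D = covered v∈D
    ... | no  v∉D = ≤-trans (n≤1+n c) (outside-D v v∉D)

  ⊤-isKTupleDom : ∀ {c} → MinDegAtLeast G c → IsKTupleDom G (suc c) ⊤
  ⊤-isKTupleDom δ = (λ _ v∉⊤ → contradiction ∈⊤ v∉⊤) ,
                    (λ v _ → ≤-trans (δ v) (≤-reflexive (cong ∣_∣ (sym (∩-identityʳ (N G v))))))

  kTupleDom⊇kDom : ∀ {c D} → MinDegAtLeast G c → IsKDom G (suc c) D → c ≤ ∣ ∁ D ∣ →
                   ∃ λ T → IsKTupleDom G (suc c) T × ∣ T ∣ + c * c ≤ suc c * ∣ D ∣
  kTupleDom⊇kDom {c} {D} δ kDom c≤∣∁D∣ with subset-of-size (∁ D) c≤∣∁D∣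
  ... | W , W⊆∁D , ∣W∣≡c with extend-to-cover δ D (D ∪ W) (<-wellFounded _)
  ... | T , D∪W⊆T , covered , ∣T∣≤ =
    T , kTupleDom-extension kDom (D∪W⊆T ∘ p⊆p∪q W) covered ,
    large-case-arithmetic {c = c} {d = ∣ D ∣} ∣T∣≤
      (≤-trans (∣p∪q∣≤∣p∣+∣q∣ D W) (≤-reflexive (cong (∣ D ∣ +_) ∣W∣≡c)))
      (deficiency+edges≤ {c} {D} (q⊆p∪q D W) (≤-reflexive ∣W∣≡c))
      (≤-trans (≤-reflexive (cong (suc c *_) (sym ∣W∣≡c))) (kDom-edges kDom W⊆∁D))

module _ (G : Graph (suc n)) where

  ∣⊤∣-bound : ∀ {c D} → MinDegAtLeast G c → IsKDom G (suc c) D → ∣ ∁ D ∣ < c →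
              ∣ ⊤ {suc n} ∣ + c * c ≤ suc c * ∣ D ∣
  ∣⊤∣-bound {c} {D} δ kDom ∣∁D∣<c = begin
    ∣ ⊤ {suc n} ∣ + c * c      ≡⟨ cong (_+ c * c) (∣⊤∣≡n (suc n)) ⟩
    suc n + c * c              ≡⟨ cong (_+ c * c) (∣p∣+∣∁p∣≡n D) ⟨
    ∣ D ∣ + ∣ ∁ D ∣ + c * c    ≡⟨ +-assoc ∣ D ∣ _ _ ⟩
    ∣ D ∣ + (∣ ∁ D ∣ + c * c)  ≤⟨ +-monoʳ-≤ ∣ D ∣ (small-case-arithmetic ∣∁D∣<c ∁D-empty ∁D-nonempty) ⟩
    ∣ D ∣ + c * ∣ D ∣          ∎
    where
    open ≤-Reasoning
    ∁D-empty : ∣ ∁ D ∣ ≡ 0 → c ≤ ∣ D ∣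
    ∁D-empty ∣∁D∣≡0 = begin
      c                ≤⟨ δ zero ⟩
      deg G zero       ≤⟨ ∣p∣≤n (N G zero) ⟩
      suc n            ≡⟨ ∣p∣+∣∁p∣≡n D ⟨
      ∣ D ∣ + ∣ ∁ D ∣  ≡⟨ cong (∣ D ∣ +_) ∣∁D∣≡0 ⟩
      ∣ D ∣ + 0        ≡⟨ +-identityʳ ∣ D ∣ ⟩
      ∣ D ∣            ∎
    ∁D-nonempty : 0 < ∣ ∁ D ∣ → suc c ≤ ∣ D ∣
    ∁D-nonempty 0<∣∁D∣ with nonempty? (∁ D)
    ... | yes (u , u∈∁D) = ≤-trans (kDom u (x∈∁p⇒x∉p u∈∁D)) (∣p∩q∣≤∣q∣ (N G u) D)
    ... | no  ∁D-empty   =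
      contradiction (trans (cong ∣_∣ (Empty-unique ∁D-empty)) (∣⊥∣≡0 (suc n))) (>⇒≢ 0<∣∁D∣)

  kTupleDom-bound : ∀ {c D} → MinDegAtLeast G c → IsKDom G (suc c) D →
                    ∃ λ T → IsKTupleDom G (suc c) T × ∣ T ∣ + c * c ≤ suc c * ∣ D ∣
  kTupleDom-bound {c} {D} δ kDom with c ≤? ∣ ∁ D ∣
  ... | yes c≤∣∁D∣ = kTupleDom⊇kDom G δ kDom c≤∣∁D∣
  ... | no  c≰∣∁D∣ = ⊤ , ⊤-isKTupleDom G δ , ∣⊤∣-bound δ kDom (≰⇒> c≰∣∁D∣)

-- The hypothesis 2 ≤ k only rules out k = 0: the bound holds for every k ≥ 1.
theorem1 : (k : ℕ) → 2 ≤ k → (n : ℕ) → (G : Graph (suc n)) →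
    MinDegAtLeast G (k ∸ 1) →
    (D : Subset (suc n)) → IsMinKDom G k D →
    (T : Subset (suc n)) → IsMinKTupleDom G k T →
    ∣ T ∣ + (k ∸ 1) * (k ∸ 1) ≤ k * ∣ D ∣
theorem1 (suc c) (s≤s _) n G δ D (kDom , _) T (_ , T-minimal) with kTupleDom-bound G δ kDom
... | T′ , T′-kTupleDom , ∣T′∣-bound = ≤-trans (+-monoˡ-≤ (c * c) (T-minimal T′ T′-kTupleDom)) ∣T′∣-bound
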